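{- For any tuple $\epsilon=(u_1,v_1,\dots,u_6,v_6)$ over $\mathbb{F}_3^*$, $\Lambda_{3,3}$ has a cycle of type $\epsilon$ if and only if there are $a,b,c,r\in\mathbb{F}_3^*$ such that $\epsilon$ equals one of $(a,r,b,-r,a,r,b,-r,a,r,b,-r)$, $(a,r,b,-r,-a,-r,c,-r,-b,r,-c,r)$, $(a,r,b,r,c,-r,-b,-r,-a,-r,-c,r)$, $(a,r,b,r,c,r,-a,-r,-c,-r,-b,-r)$, $(a,r,b,r,c,r,-a,r,-b,r,-c,r)$.
   Context: For a prime power $q$ and integer $k\ge2$, $\Lambda_{k,q}$ is the bipartite graph with vertex set $L_k\cup R_k$ (regarded as disjoint), where $L_k$ is the set of vectors $[l]=(l_0,\dots,l_k)\in\mathbb{F}_q^{k+1}$ with $l_1=l_2$ and $R_k$ the set of vectors $\langle r\rangle=(r_0,\dots,r_k)\in\mathbb{F}_q^{k+1}$ with $r_1=0$; edges join only $L_k$ to $R_k$, and $[l]\sim\langle r\rangle$ iff for every $2\le i\le k$: $l_i+r_i=r_0l_{i-2}$ if $i\equiv2,3\pmod4$, and $l_i+r_i=l_0r_{i-2}$ if $i\equiv0,1\pmod4$. A cycle of length $2n$ through the edge joining the two all-zero vectors is written $[l^{(1)}],\langle r^{(1)}\rangle,\dots,[l^{(n)}],\langle r^{(n)}\rangle$ (distinct vertices, consecutive ones adjacent, $\langle r^{(n)}\rangle\sim[l^{(1)}]$) with $[l^{(1)}]$ and $\langle r^{(1)}\rangle$ the all-zero vectors. Put $x_i=l^{(i)}_0$,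 $y_i=r^{(i)}_0$ ($1\le i\le n$), $x_{n+1}=y_{n+1}=0$, $u_i=x_{i+1}-x_i$, $v_i=y_{i+1}-y_i$; the tuple $(u_1,v_1,\dots,u_n,v_n)$ is the type of the cycle, and "has a cycle of type $\epsilon$" means such a cycle with type $\epsilon$ exists. -}

module Defs where

open import Data.Nat using (ℕ; zero; suc)
open import Data.Fin using (Fin; zero; suc)
open import Data.Maybe using (Maybe; just; nothing; maybe)
import Data.Maybe as Maybe
open import Data.Vec using (Vec; []; _∷_; lookup; replicate; tabulate; concat)
open import Data.Product using (Σ; _×_)
open import Relation.Binary.PropositionalEquality using (_≡_; _≢_)

data 𝔽₃ : Set where
  f0 f1 f2 : 𝔽₃

infixl 6 _+_ _-_
infixl 7 _*_

_+_ : 𝔽₃ → 𝔽₃ → 𝔽₃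
f0 + y  = y
f1 + f0 = f1
f1 + f1 = f2
f1 + f2 = f0
f2 + f0 = f2
f2 + f1 = f0
f2 + f2 = f1

-_ : 𝔽₃ → 𝔽₃
- f0 = f0
- f1 = f2
- f2 = f1

_-_ : 𝔽₃ → 𝔽₃ → 𝔽₃
x - y = x + (- y)

_*_ : 𝔽₃ → 𝔽₃ → 𝔽₃
f0 * y = f0
f1 * y = y
f2 * y = - y

NonZero : 𝔽₃ → Set
NonZero x = x ≢ f0

-- The graph Λ_{3,3}: vectors (v₀,v₁,v₂,v₃) ∈ 𝔽₃⁴

V : Set
V = Vec 𝔽₃ 4

c0 c1 c2 c3 : V → 𝔽₃
c0 v = lookup v zero
c1 v = lookup v (suc zero)
c2 v = lookup v (suc (suc zero))
c3 v = lookup v (suc (suc (suc zero)))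

InL : V → Set
InL l = c1 l ≡ c2 l

InR : V → Set
InR r = c1 r ≡ f0

-- adjacency [l] ∼ ⟨r⟩ for k = 3:
--   i = 2 (≡ 2 mod 4): l₂ + r₂ = r₀ l₀
--   i = 3 (≡ 3 mod 4): l₃ + r₃ = r₀ l₁
Adj : V → V → Set
Adj l r = (c2 l + c2 r ≡ c0 r * c0 l) × (c3 l + c3 r ≡ c0 r * c1 l)

zeroV : V
zeroV = replicate 4 f0

-- Cycles of length 2n (n = suc m) through the edge joining the zero vectors.
-- Index i : Fin n stands for the paper's index i+1.

succ? : ∀ {m} → Fin (suc m) → Maybe (Fin (suc m))
succ? {zero}  zero    = nothing
succ? {suc m} zero    = just (suc zero)
succ? {suc m} (suc i) = Maybe.map suc (succ? i)

csuc : ∀ {m} → Fin (suc m) → Fin (suc m)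
csuc i = maybe (λ j → j) zero (succ? i)

record Cycle (m : ℕ) : Set where
  field
    L R   : Fin (suc m) → V
    L-in  : ∀ i → InL (L i)
    R-in  : ∀ i → InR (R i)
    L-zero : L zero ≡ zeroV
    R-zero : R zero ≡ zeroV
    L-inj : ∀ i j → L i ≡ L j → i ≡ j
    R-inj : ∀ i j → R i ≡ R j → i ≡ j
    adj-LR : ∀ i → Adj (L i) (R i)
    adj-RL : ∀ i → Adj (L (csuc i)) (R i)

  x y : Fin (suc m) → 𝔽₃
  x i = c0 (L i)
  y i = c0 (R i)

  -- x_{i+1}, y_{i+1}, with x_{n+1} = y_{n+1} = 0
  xnext ynext : Fin (suc m) → 𝔽₃
  xnext i = maybe x f0 (succ? i)
  ynext i = maybe y f0 (succ? i)

  u v : Fin (suc m) → 𝔽₃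
  u i = xnext i - x i
  v i = ynext i - y i

  type : Vec 𝔽₃ (suc m Data.Nat.* 2)
  type = concat (tabulate (λ i → u i ∷ v i ∷ []))

HasCycleOfType : (m : ℕ) → Vec 𝔽₃ (suc m Data.Nat.* 2) → Set
HasCycleOfType m ε = Σ (Cycle m) (λ C → Cycle.type C ≡ ε)

-- In Λ_{3,3} every vertex has exactly one neighbour with a prescribed first
-- coordinate.  A cycle through the origin is therefore the unique zigzag walk
-- whose first coordinates x_i, y_i are the partial sums of the u's and v's of
-- its type, so "there is a cycle of type ε" is decidable: build that walk and
-- check that it closes up, is injective and has type ε.  The theorem is then
-- a finite computation over the 2¹² nonzero types and the 2⁴ parameters a, b, c, r.
module Submission where

open import Defs
open import Data.Empty using (⊥-elim)
open import Data.Fin using (Fin; zero; suc; inject₁)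
open import Data.Fin.Properties using (all?) renaming (_≟_ to _≟ᶠ_)
open import Data.Maybe using (just; nothing; maybe)
import Data.Maybe as Maybe
open import Data.Nat using (ℕ; zero; suc)
open import Data.Product using (∃; _×_; _,_)
open import Data.Sum using (_⊎_; inj₁; inj₂; [_,_])
open import Data.Unit using (tt)
open import Data.Vec using (Vec; []; _∷_; lookup; tabulate; concat)
open import Data.Vec.Properties using (≡-dec; tabulate-cong)
open import Data.Vec.Relation.Unary.All using (All; []; _∷_)
open import Function using (_∘_)
open import Function.Bundles using (_⇔_; mk⇔)
open import Relation.Binary.Definitions using (DecidableEquality)
open import Relation.Binary.PropositionalEquality
  using (_≡_; _≗_; refl; sym; trans; cong; cong₂; subst; subst₂)
open import Relation.Nullary using (Dec; yes; no; ¬?)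
open import Relation.Nullary.Decidable using (map′; toWitness; _×-dec_; _⊎-dec_; _→-dec_)
open import Relation.Unary using (Decidable)

infix 4 _≟_ _≟ᵛ_

_≟_ : DecidableEquality 𝔽₃
f0 ≟ f0 = yes refl
f0 ≟ f1 = no λ ()
f0 ≟ f2 = no λ ()
f1 ≟ f0 = no λ ()
f1 ≟ f1 = yes refl
f1 ≟ f2 = no λ ()
f2 ≟ f0 = no λ ()
f2 ≟ f1 = no λ ()
f2 ≟ f2 = yes refl

_≟ᵛ_ : ∀ {n} → DecidableEquality (Vec 𝔽₃ n)
_≟ᵛ_ = ≡-dec _≟_

nonZero? : Decidable NonZero
nonZero? a = ¬? (a ≟ f0)

+-comm : ∀ a b → a + b ≡ b + a
+-comm f0 f0 = refl
+-comm f0 f1 = refl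
+-comm f0 f2 = refl
+-comm f1 f0 = refl
+-comm f1 f1 = refl
+-comm f1 f2 = refl
+-comm f2 f0 = refl
+-comm f2 f1 = refl
+-comm f2 f2 = refl

a+[b-a]≡b : ∀ a b → a + (b - a) ≡ b
a+[b-a]≡b f0 f0 = refl
a+[b-a]≡b f0 f1 = refl
a+[b-a]≡b f0 f2 = refl
a+[b-a]≡b f1 f0 = refl
a+[b-a]≡b f1 f1 = refl
a+[b-a]≡b f1 f2 = refl
a+[b-a]≡b f2 f0 = refl
a+[b-a]≡b f2 f1 = refl
a+[b-a]≡b f2 f2 = refl

b≡[a+b]-a : ∀ a b → b ≡ (a + b) - a
b≡[a+b]-a f0 f0 = refl
b≡[a+b]-a f0 f1 = refl
b≡[a+b]-a f0 f2 = refl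
b≡[a+b]-a f1 f0 = refl
b≡[a+b]-a f1 f1 = refl
b≡[a+b]-a f1 f2 = refl
b≡[a+b]-a f2 f0 = refl
b≡[a+b]-a f2 f1 = refl
b≡[a+b]-a f2 f2 = refl

a+b≡c⇒b≡c-a : ∀ {a b c} → a + b ≡ c → b ≡ c - a
a+b≡c⇒b≡c-a {a} {b} refl = b≡[a+b]-a a b

a+b≡c⇒a≡c-b : ∀ {a b c} → a + b ≡ c → a ≡ c - b
a+b≡c⇒a≡c-b {a} {b} eq = a+b≡c⇒b≡c-a (trans (+-comm b a) eq)

rightNeighbour : V → 𝔽₃ → V
rightNeighbour l y = y ∷ f0 ∷ y * c0 l - c2 l ∷ y * c1 l - c3 l ∷ []

leftNeighbour : V → 𝔽₃ → V
leftNeighbour r x = x ∷ w ∷ w ∷ c0 r * w - c3 r ∷ []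
  where w = c0 r * x - c2 r

rightNeighbour-adj : ∀ l y → Adj l (rightNeighbour l y)
rightNeighbour-adj l y = a+[b-a]≡b (c2 l) (y * c0 l) , a+[b-a]≡b (c3 l) (y * c1 l)

rightNeighbour-unique : ∀ {l r} → InR r → Adj l r → r ≡ rightNeighbour l (c0 r)
rightNeighbour-unique {r = r0 ∷ .f0 ∷ r2 ∷ r3 ∷ []} refl (e2 , e3) =
  cong₂ (λ s t → r0 ∷ f0 ∷ s ∷ t ∷ []) (a+b≡c⇒b≡c-a e2) (a+b≡c⇒b≡c-a e3)

leftNeighbour-unique : ∀ {l r} → InL l → Adj l r → l ≡ leftNeighbour r (c0 l)
leftNeighbour-unique {l = l0 ∷ w ∷ .w ∷ l3 ∷ []} {r} refl (e2 , e3) =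
  trans (cong (λ t → l0 ∷ w ∷ w ∷ t ∷ []) (a+b≡c⇒a≡c-b e3))
        (cong (λ s → l0 ∷ s ∷ s ∷ c0 r * s - c3 r ∷ []) (a+b≡c⇒a≡c-b e2))

record Walk (m : ℕ) : Set where
  field
    L R    : Fin (suc m) → V
    L-in   : ∀ i → InL (L i)
    R-in   : ∀ i → InR (R i)
    L-zero : L zero ≡ zeroV
    adj-LR : ∀ i → Adj (L i) (R i)
    adj-RL : ∀ i → Adj (L (suc i)) (R (inject₁ i))

restrict : ∀ {m} → Walk (suc m) → Walk m
restrict W = record
  { L = L ∘ inject₁ ; R = R ∘ inject₁
  ; L-in = L-in ∘ inject₁ ; R-in = R-in ∘ inject₁ ; L-zero = L-zero
  ; adj-LR = adj-LR ∘ inject₁ ; adj-RL = adj-RL ∘ inject₁ }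
  where open Walk W

walkL walkR : ∀ {m} → (x y : Fin (suc m) → 𝔽₃) → Fin (suc m) → V
walkL         x y zero    = zeroV
walkL {suc m} x y (suc i) = leftNeighbour (walkR (x ∘ inject₁) (y ∘ inject₁) i) (x (suc i))
walkR         x y i       = rightNeighbour (walkL x y i) (y i)

walkL-in : ∀ {m} (x y : Fin (suc m) → 𝔽₃) i → InL (walkL x y i)
walkL-in         x y zero    = refl
walkL-in {suc m} x y (suc i) = refl

walkL-unique : ∀ {m} (W : Walk m) {x y} → (∀ i → c0 (Walk.L W i) ≡ x i) →
               (∀ i → c0 (Walk.R W i) ≡ y i) → ∀ i → Walk.L W i ≡ walkL x y i
walkR-unique : ∀ {m} (W : Walk m) {x y} → (∀ i → c0 (Walk.L W i) ≡ x i) →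
               (∀ i → c0 (Walk.R W i) ≡ y i) → ∀ i → Walk.R W i ≡ walkR x y i

walkL-unique W px py zero = Walk.L-zero W
walkL-unique {suc m} W px py (suc i) =
  trans (leftNeighbour-unique {r = R (inject₁ i)} (L-in (suc i)) (adj-RL i))
        (cong₂ leftNeighbour (walkR-unique (restrict W) (px ∘ inject₁) (py ∘ inject₁) i)
                             (px (suc i)))
  where open Walk W

walkR-unique W px py i =
  trans (rightNeighbour-unique {l = L i} (R-in i) (adj-LR i))
        (cong₂ rightNeighbour (walkL-unique W px py i) (py i))
  where open Walk W

interleave : ∀ {n} {A : Set} → (Fin n → A) → (Fin n → A) → Vec A (n Data.Nat.* 2)
interleave f g = concat (tabulate λ i → f i ∷ g i ∷ [])

evens odds : ∀ n {A : Set} → Vec A (n Data.Nat.* 2) → Vec A n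
evens zero    []           = []
evens (suc n) (a ∷ _ ∷ as) = a ∷ evens n as
odds  zero    []           = []
odds  (suc n) (_ ∷ b ∷ as) = b ∷ odds n as

lookup-evens-interleave : ∀ {n A} (f g : Fin n → A) i → lookup (evens n (interleave f g)) i ≡ f i
lookup-evens-interleave f g zero    = refl
lookup-evens-interleave f g (suc i) = lookup-evens-interleave (f ∘ suc) (g ∘ suc) i

lookup-odds-interleave : ∀ {n A} (f g : Fin n → A) i → lookup (odds n (interleave f g)) i ≡ g i
lookup-odds-interleave f g zero    = refl
lookup-odds-interleave f g (suc i) = lookup-odds-interleave (f ∘ suc) (g ∘ suc) i

interleave-cong : ∀ {n A} {f f′ g g′ : Fin n → A} → f ≗ f′ → g ≗ g′ →
                  interleave f g ≡ interleave f′ g′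
interleave-cong p q = cong concat (tabulate-cong λ i → cong₂ (λ a b → a ∷ b ∷ []) (p i) (q i))

differences : ∀ {m} → (Fin (suc m) → 𝔽₃) → Fin (suc m) → 𝔽₃
differences x i = maybe x f0 (succ? i) - x i

differences-cong : ∀ {m} {x x′ : Fin (suc m) → 𝔽₃} → x ≗ x′ → differences x ≗ differences x′
differences-cong {x = x} {x′} p i = cong₂ _-_ (next (succ? i)) (p i)
  where
  next : ∀ j? → maybe x f0 j? ≡ maybe x′ f0 j?
  next (just j) = p j
  next nothing  = refl

typeOf : ∀ {m} → (x y : Fin (suc m) → 𝔽₃) → Vec 𝔽₃ (suc m Data.Nat.* 2)
typeOf x y = interleave (differences x) (differences y)

succ?-inject₁ : ∀ {m} (i : Fin m) → succ? (inject₁ i) ≡ just (suc i)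
succ?-inject₁ zero    = refl
succ?-inject₁ (suc i) = cong (Maybe.map suc) (succ?-inject₁ i)

differences-inject₁ : ∀ {m} (x : Fin (suc m) → 𝔽₃) (i : Fin m) →
                      differences x (inject₁ i) ≡ x (suc i) - x (inject₁ i)
differences-inject₁ x i = cong (λ j? → maybe x f0 j? - x (inject₁ i)) (succ?-inject₁ i)

partialSums : ∀ {n} → 𝔽₃ → Vec 𝔽₃ n → Fin (suc n) → 𝔽₃
partialSums s ds       zero    = s
partialSums s (d ∷ ds) (suc i) = partialSums (s + d) ds i

-- The last entry of ds, the closing difference x_{n+1} − x_n, is unconstrained.
partialSums-differences : ∀ {n} (x : Fin (suc n) → 𝔽₃) (ds : Vec 𝔽₃ (suc n)) →
  (∀ j → lookup ds (inject₁ j) ≡ x (suc j) - x (inject₁ j)) →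
  ∀ i → partialSums (x zero) ds (inject₁ i) ≡ x i
partialSums-differences x ds        ds≡ zero    = refl
partialSums-differences {suc n} x (d ∷ ds) ds≡ (suc i) =
  trans (cong (λ s → partialSums s ds (inject₁ i)) x₀+d≡x₁)
        (partialSums-differences (x ∘ suc) ds (ds≡ ∘ suc) i)
  where
  x₀+d≡x₁ : x zero + d ≡ x (suc zero)
  x₀+d≡x₁ = trans (cong (x zero +_) (ds≡ zero)) (a+[b-a]≡b (x zero) (x (suc zero)))

partialSums-differences₀ : ∀ {m} (x : Fin (suc m) → 𝔽₃) → x zero ≡ f0 →
  (ds : Vec 𝔽₃ (suc m)) → (∀ j → lookup ds j ≡ differences x j) → ∀ i → partialSums f0 ds (inject₁ i) ≡ x i
partialSums-differences₀ x x₀≡0 ds ds≡ i =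
  trans (cong (λ s → partialSums s ds (inject₁ i)) (sym x₀≡0))
        (partialSums-differences x ds (λ j → trans (ds≡ (inject₁ j)) (differences-inject₁ x j)) i)

module _ (m : ℕ) (ε : Vec 𝔽₃ (suc m Data.Nat.* 2)) where

  candidateX candidateY : Fin (suc m) → 𝔽₃
  candidateX i = partialSums f0 (evens (suc m) ε) (inject₁ i)
  candidateY i = partialSums f0 (odds (suc m) ε) (inject₁ i)

  candidateL candidateR : Fin (suc m) → V
  candidateL = walkL candidateX candidateY
  candidateR = walkR candidateX candidateY

  -- Only the closing adjacency (at the last index) is not automatic.
  CandidateIsCycle : Set
  CandidateIsCycle =
    typeOf (c0 ∘ candidateL) (c0 ∘ candidateR) ≡ ε ×
    (∀ i → Adj (candidateL (csuc i)) (candidateR i)) ×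
    (∀ i j → candidateL i ≡ candidateL j → i ≡ j) ×
    (∀ i j → candidateR i ≡ candidateR j → i ≡ j)

adj? : ∀ l r → Dec (Adj l r)
adj? l r = (c2 l + c2 r ≟ c0 r * c0 l) ×-dec (c3 l + c3 r ≟ c0 r * c1 l)

injective? : ∀ {n} (f : Fin n → V) → Dec (∀ i j → f i ≡ f j → i ≡ j)
injective? f = all? λ i → all? λ j → (f i ≟ᵛ f j) →-dec (i ≟ᶠ j)

candidateIsCycle? : ∀ {m} → Decidable (CandidateIsCycle m)
candidateIsCycle? {m} ε =
  typeOf (c0 ∘ candidateL m ε) (c0 ∘ candidateR m ε) ≟ᵛ ε ×-dec
  all? (λ i → adj? (candidateL m ε (csuc i)) (candidateR m ε i)) ×-dec
  injective? (candidateL m ε) ×-dec injective? (candidateR m ε)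

candidateIsCycle⇒hasCycle : ∀ {m} ε → CandidateIsCycle m ε → HasCycleOfType m ε
candidateIsCycle⇒hasCycle {m} ε (type≡ε , adj-RL , L-inj , R-inj) = record
  { L = candidateL m ε ; R = candidateR m ε
  ; L-in = walkL-in (candidateX m ε) (candidateY m ε) ; R-in = λ _ → refl
  ; L-zero = refl ; R-zero = refl
  ; L-inj = L-inj ; R-inj = R-inj
  ; adj-LR = λ i → rightNeighbour-adj (candidateL m ε i) (candidateY m ε i)
  ; adj-RL = adj-RL } , type≡ε

csuc-inject₁ : ∀ {m} (i : Fin m) → csuc (inject₁ i) ≡ suc i
csuc-inject₁ i = cong (maybe (λ j → j) zero) (succ?-inject₁ i)

module _ {m} (C : Cycle m) where
  open Cycle C

  walkOfCycle : Walk m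
  walkOfCycle = record
    { L = L ; R = R ; L-in = L-in ; R-in = R-in ; L-zero = L-zero ; adj-LR = adj-LR
    ; adj-RL = λ i → subst (λ j → Adj (L j) (R (inject₁ i))) (csuc-inject₁ i) (adj-RL (inject₁ i))
    }

  x≗candidateX : ∀ i → x i ≡ candidateX m type i
  x≗candidateX i = sym (partialSums-differences₀ x (cong c0 L-zero) _ (lookup-evens-interleave u v) i)

  y≗candidateY : ∀ i → y i ≡ candidateY m type i
  y≗candidateY i = sym (partialSums-differences₀ y (cong c0 R-zero) _ (lookup-odds-interleave u v) i)

  L≗candidateL : ∀ i → L i ≡ candidateL m type i
  L≗candidateL = walkL-unique walkOfCycle x≗candidateX y≗candidateY

  R≗candidateR : ∀ i → R i ≡ candidateR m type i
  R≗candidateR = walkR-unique walkOfCycle x≗candidateX y≗candidateY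

hasCycle⇒candidateIsCycle : ∀ {m} ε → HasCycleOfType m ε → CandidateIsCycle m ε
hasCycle⇒candidateIsCycle {m} _ (C , refl) =
  sym (interleave-cong (differences-cong (cong c0 ∘ L≗)) (differences-cong (cong c0 ∘ R≗))) ,
  (λ i → subst₂ Adj (L≗ (csuc i)) (R≗ i) (adj-RL i)) ,
  (λ i j eq → L-inj i j (trans (L≗ i) (trans eq (sym (L≗ j))))) ,
  (λ i j eq → R-inj i j (trans (R≗ i) (trans eq (sym (R≗ j)))))
  where
  open Cycle C
  L≗ : ∀ i → L i ≡ candidateL m type i
  L≗ = L≗candidateL C
  R≗ : ∀ i → R i ≡ candidateR m type i
  R≗ = R≗candidateR C

hasCycleOfType? : ∀ m → Decidable (HasCycleOfType m)
hasCycleOfType? m ε =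
  map′ (candidateIsCycle⇒hasCycle ε) (hasCycle⇒candidateIsCycle ε) (candidateIsCycle? {m} ε)

any𝔽₃? : {P : 𝔽₃ → Set} → Decidable P → Dec (∃ P)
any𝔽₃? {P} P? = map′ witness choose (P? f0 ⊎-dec P? f1 ⊎-dec P? f2)
  where
  witness : P f0 ⊎ P f1 ⊎ P f2 → ∃ P
  witness (inj₁ p)        = f0 , p
  witness (inj₂ (inj₁ p)) = f1 , p
  witness (inj₂ (inj₂ p)) = f2 , p
  choose : ∃ P → P f0 ⊎ P f1 ⊎ P f2
  choose (f0 , p) = inj₁ p
  choose (f1 , p) = inj₂ (inj₁ p)
  choose (f2 , p) = inj₂ (inj₂ p)

allNonZero? : ∀ n {P : Vec 𝔽₃ n → Set} → Decidable P → Dec (∀ ε → All NonZero ε → P ε)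
allNonZero? zero    P? = map′ (λ { p [] [] → p }) (λ h → h [] []) (P? [])
allNonZero? (suc n) {P} P? =
  map′ combine split (allNonZero? n (P? ∘ (f1 ∷_)) ×-dec allNonZero? n (P? ∘ (f2 ∷_)))
  where
  combine : (∀ ε → All NonZero ε → P (f1 ∷ ε)) × (∀ ε → All NonZero ε → P (f2 ∷ ε)) →
            ∀ ε → All NonZero ε → P ε
  combine (h₁ , h₂) (f0 ∷ ε) (a≢0 ∷ _) = ⊥-elim (a≢0 refl)
  combine (h₁ , h₂) (f1 ∷ ε) (_ ∷ nz)  = h₁ ε nz
  combine (h₁ , h₂) (f2 ∷ ε) (_ ∷ nz)  = h₂ ε nz
  split : (∀ ε → All NonZero ε → P ε) →
          (∀ ε → All NonZero ε → P (f1 ∷ ε)) × (∀ ε → All NonZero ε → P (f2 ∷ ε))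
  split h = (λ ε nz → h (f1 ∷ ε) ((λ ()) ∷ nz)) , (λ ε nz → h (f2 ∷ ε) ((λ ()) ∷ nz))

shape₁ shape₂ shape₃ shape₄ shape₅ : 𝔽₃ → 𝔽₃ → 𝔽₃ → 𝔽₃ → Vec 𝔽₃ 12
shape₁ a b c r = a ∷ r ∷ b ∷ - r ∷ a ∷ r ∷ b ∷ - r ∷ a ∷ r ∷ b ∷ - r ∷ []
shape₂ a b c r = a ∷ r ∷ b ∷ - r ∷ - a ∷ - r ∷ c ∷ - r ∷ - b ∷ r ∷ - c ∷ r ∷ []
shape₃ a b c r = a ∷ r ∷ b ∷ r ∷ c ∷ - r ∷ - b ∷ - r ∷ - a ∷ - r ∷ - c ∷ r ∷ []
shape₄ a b c r = a ∷ r ∷ b ∷ r ∷ c ∷ r ∷ - a ∷ - r ∷ - c ∷ - r ∷ - b ∷ - r ∷ []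
shape₅ a b c r = a ∷ r ∷ b ∷ r ∷ c ∷ r ∷ - a ∷ r ∷ - b ∷ r ∷ - c ∷ r ∷ []

OfShape : 𝔽₃ → 𝔽₃ → 𝔽₃ → 𝔽₃ → Vec 𝔽₃ 12 → Set
OfShape a b c r ε =
  ε ≡ shape₁ a b c r ⊎ ε ≡ shape₂ a b c r ⊎ ε ≡ shape₃ a b c r ⊎
  ε ≡ shape₄ a b c r ⊎ ε ≡ shape₅ a b c r

OfListedShape : Vec 𝔽₃ 12 → Set
OfListedShape ε = ∃ λ a → ∃ λ b → ∃ λ c → ∃ λ r →
  NonZero a × NonZero b × NonZero c × NonZero r × OfShape a b c r ε

ofListedShape? : Decidable OfListedShape
ofListedShape? ε =
  any𝔽₃? λ a → any𝔽₃? λ b → any𝔽₃? λ c → any𝔽₃? λ r →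
    nonZero? a ×-dec nonZero? b ×-dec nonZero? c ×-dec nonZero? r ×-dec
    (ε ≟ᵛ shape₁ a b c r ⊎-dec ε ≟ᵛ shape₂ a b c r ⊎-dec ε ≟ᵛ shape₃ a b c r
      ⊎-dec ε ≟ᵛ shape₄ a b c r ⊎-dec ε ≟ᵛ shape₅ a b c r)

hasCycle⇒ofListedShape : ∀ ε → All NonZero ε → HasCycleOfType 5 ε → OfListedShape ε
hasCycle⇒ofListedShape =
  toWitness {a? = allNonZero? 12 λ ε → hasCycleOfType? 5 ε →-dec ofListedShape? ε} tt

ShapesHaveCycles : Vec 𝔽₃ 4 → Set
ShapesHaveCycles (a ∷ b ∷ c ∷ r ∷ []) = ∀ ε → OfShape a b c r ε → HasCycleOfType 5 ε

shapesHaveCycles? : Decidable ShapesHaveCycles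
shapesHaveCycles? (a ∷ b ∷ c ∷ r ∷ []) =
  map′ (λ (h₁ , h₂ , h₃ , h₄ , h₅) _ → [ at h₁ , [ at h₂ , [ at h₃ , [ at h₄ , at h₅ ] ] ] ])
       (λ h → h _ (inj₁ refl) , h _ (inj₂ (inj₁ refl)) , h _ (inj₂ (inj₂ (inj₁ refl)))
            , h _ (inj₂ (inj₂ (inj₂ (inj₁ refl)))) , h _ (inj₂ (inj₂ (inj₂ (inj₂ refl)))))
       (has (shape₁ a b c r) ×-dec has (shape₂ a b c r) ×-dec has (shape₃ a b c r)
         ×-dec has (shape₄ a b c r) ×-dec has (shape₅ a b c r))
  where
  has : Decidable (HasCycleOfType 5)
  has = hasCycleOfType? 5
  at : ∀ {ε ε′} → HasCycleOfType 5 ε′ → ε ≡ ε′ → HasCycleOfType 5 ε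
  at h refl = h

ofListedShape⇒hasCycle : ∀ ε → OfListedShape ε → HasCycleOfType 5 ε
ofListedShape⇒hasCycle ε (a , b , c , r , a≢0 , b≢0 , c≢0 , r≢0 , shape) =
  toWitness {a? = allNonZero? 4 shapesHaveCycles?} tt
    (a ∷ b ∷ c ∷ r ∷ []) (a≢0 ∷ b≢0 ∷ c≢0 ∷ r≢0 ∷ []) ε shape

lemma6 : (ε : Vec 𝔽₃ 12) → All NonZero ε →
  (HasCycleOfType 5 ε ⇔
    ∃ λ a → ∃ λ b → ∃ λ c → ∃ λ r →
      NonZero a × NonZero b × NonZero c × NonZero r ×
      (ε ≡ a ∷ r ∷ b ∷ - r ∷ a ∷ r ∷ b ∷ - r ∷ a ∷ r ∷ b ∷ - r ∷ []
      ⊎ ε ≡ a ∷ r ∷ b ∷ - r ∷ - a ∷ - r ∷ c ∷ - r ∷ - b ∷ r ∷ - c ∷ r ∷ []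
      ⊎ ε ≡ a ∷ r ∷ b ∷ r ∷ c ∷ - r ∷ - b ∷ - r ∷ - a ∷ - r ∷ - c ∷ r ∷ []
      ⊎ ε ≡ a ∷ r ∷ b ∷ r ∷ c ∷ r ∷ - a ∷ - r ∷ - c ∷ - r ∷ - b ∷ - r ∷ []
      ⊎ ε ≡ a ∷ r ∷ b ∷ r ∷ c ∷ r ∷ - a ∷ r ∷ - b ∷ r ∷ - c ∷ r ∷ []))
lemma6 ε nz = mk⇔ (hasCycle⇒ofListedShape ε nz) (ofListedShape⇒hasCycle ε)
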